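{- Let $G$ be a connected graph with a modular partition $P=\{M_1,\dots,M_k\}$. Let $T$ be a MAD tree of $G$ with root $r\in M_i$. Then there is no edge $uv\in E(T)$ with $u,v\in M_j$ for any $M_j\in P\setminus\{M_i\}$.
   Context: Graphs are simple, undirected, unweighted. The Wiener index is $\mathrm{W}(H)=\sum_{\{u,v\}\subseteq V(H)}\mathrm{dist}_H(u,v)$. A MAD tree of $G$ is a spanning tree of $G$ of minimum Wiener index. A module of $G$ is a set $M\subseteq V(G)$ such that every vertex outside $M$ is adjacent to all or to none of the vertices of $M$; a modular partition is a partition of $V(G)$ into $k\ge2$ modules. A vertex $r$ is a root of a MAD tree $T$ of $G$ if every path in $T$ starting at $r$ is an induced path in $G$. -}

module Defs where

open import Data.Nat using (ℕ; zero; suc; _+_; _≤_; _∸_)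
open import Data.Bool using (Bool; true; false; _∧_; _∨_; not; if_then_else_)
open import Data.Fin using (Fin; toℕ; _<_)
open import Data.Fin.Properties using (_≟_)
open import Data.Nat.ListAction using (sum)
open import Data.List using (List; []; _∷_; map; allFin; upTo; filter; length; lookup)
open import Data.List.Relation.Unary.Unique.Propositional using (Unique)
open import Data.List.Relation.Unary.Any using (any?)
open import Data.Product using (Σ; _×_; _,_; ∃)
open import Relation.Binary.PropositionalEquality using (_≡_; _≢_)
open import Relation.Nullary using (¬_; does)

record Graph (n : ℕ) : Set where
  field
    adj   : Fin n → Fin n → Bool
    sym   : ∀ u v → adj u v ≡ adj v u
    irrefl : ∀ u → adj u u ≡ false
open Graph public

Adj : ∀ {n} → Graph n → Fin n → Fin n → Set
Adj G u v = adj G u v ≡ true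

anyFin : ∀ {n} → (Fin n → Bool) → Bool
anyFin {n} p = Data.List.foldr (λ i b → p i ∨ b) false (allFin n)

reach : ∀ {n} → Graph n → ℕ → Fin n → Fin n → Bool
reach G zero    u v = does (u ≟ v)
reach G (suc k) u v = reach G k u v ∨ anyFin (λ w → reach G k u w ∧ adj G w v)

Connected : ∀ {n} → Graph n → Set
Connected {n} G = ∀ u v → reach G n u v ≡ true

-- Distance: the least k with reach G k u v, computed as the number of
-- k ∈ {0,…,n-1} for which v is not reachable within k steps.
-- (For connected graphs this is the usual shortest-path distance.)
dist : ∀ {n} → Graph n → Fin n → Fin n → ℕ
dist {n} G u v = sum (map (λ k → if reach G k u v then 0 else 1) (upTo n))

wiener : ∀ {n} → Graph n → ℕ
wiener {n} G =
  sum (map (λ u → sum (map (λ v → if does (Data.Fin._<?_ u v) then dist G u v else 0)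
                           (allFin n)))
           (allFin n))

edgeCount : ∀ {n} → Graph n → ℕ
edgeCount {n} G =
  sum (map (λ u → sum (map (λ v → if does (Data.Fin._<?_ u v) ∧ adj G u v then 1 else 0)
                           (allFin n)))
           (allFin n))

IsTree : ∀ {n} → Graph n → Set
IsTree {n} T = Connected T × edgeCount T ≡ n ∸ 1

Subgraph : ∀ {n} → Graph n → Graph n → Set
Subgraph T G = ∀ u v → Adj T u v → Adj G u v

SpanningTree : ∀ {n} → Graph n → Graph n → Set
SpanningTree G T = Subgraph T G × IsTree T

MADTree : ∀ {n} → Graph n → Graph n → Set
MADTree G T = SpanningTree G T × (∀ T' → SpanningTree G T' → wiener T ≤ wiener T')

data Walk {n} (H : Graph n) : List (Fin n) → Set where
  []  : Walk H []
  [_] : ∀ v → Walk H (v ∷ [])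
  _∷_ : ∀ {u v vs} → Adj H u v → Walk H (v ∷ vs) → Walk H (u ∷ v ∷ vs)

IsPath : ∀ {n} → Graph n → List (Fin n) → Set
IsPath H vs = Walk H vs × Unique vs

IsInducedPath : ∀ {n} → Graph n → List (Fin n) → Set
IsInducedPath G vs =
  IsPath G vs ×
  (∀ (i j : Fin (length vs)) → suc (suc (toℕ i)) ≤ toℕ j →
     ¬ Adj G (lookup vs i) (lookup vs j))

IsRoot : ∀ {n} → Graph n → Graph n → Fin n → Set
IsRoot G T r = ∀ vs → IsPath T (r ∷ vs) → IsInducedPath G (r ∷ vs)

IsModule : ∀ {n} → Graph n → (Fin n → Set) → Set
IsModule {n} G M =
  ∀ x → ¬ M x →
    (∀ m → M m → Adj G x m) ⊎' (∀ m → M m → ¬ Adj G x m)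
  where
  open import Data.Sum using () renaming (_⊎_ to _⊎'_)

record ModularPartition {n} (G : Graph n) (k : ℕ) : Set where
  field
    block     : Fin n → Fin k
    k≥2       : 2 ≤ k
    nonempty  : ∀ j → ∃ λ v → block v ≡ j
    isModule  : ∀ j → IsModule G (λ v → block v ≡ j)
open ModularPartition public

{-# OPTIONS --safe #-}
-- Since T is connected, some path of T
-- starts at r and passes through both ends of the edge uv (follow a path from r to u, then step to
-- v unless it was already visited); as r is a root, this path is induced in G. But an induced path
-- that starts outside a module M meets M at most once: at the first vertex y ∈ M, the predecessor of
-- y lies outside M and is adjacent to y, hence to all of M, so any later vertex of M would give a
-- chord.
module Submission where

open import Defs
open import Data.Nat using (ℕ; zero; suc; s≤s; z≤n)
open import Data.Fin using (Fin)
import Data.Fin as Fin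
open import Data.Fin.Properties using (_≟_)
open import Data.Bool using (Bool; true; false; _∨_)
open import Data.Bool.Properties using (∧-conicalˡ; ∧-conicalʳ)
open import Data.Product using (_×_; ∃; ∃₂; Σ; _,_; proj₁)
open import Data.Sum using (_⊎_; inj₁; inj₂)
open import Data.Empty using (⊥; ⊥-elim)
open import Data.List using (List; []; _∷_; _++_; foldr; allFin)
open import Data.List.Properties using (++-identityʳ)
open import Data.List.Relation.Unary.All as All using (All; []; _∷_)
open import Data.List.Relation.Unary.AllPairs using ([]; _∷_)
open import Data.List.Relation.Unary.Any using (here; there; index)
import Data.List.Relation.Unary.Any as Any
open import Data.List.Relation.Unary.Any.Properties using (lookup-index)
open import Data.List.Relation.Unary.Unique.Propositional using (Unique)
import Data.List.Relation.Unary.Unique.Propositional.Properties as Unique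
open import Data.List.Membership.Propositional using (_∈_)
open import Data.List.Membership.Propositional.Properties using (∈-++⁺ˡ; ∈-++⁺ʳ)
import Data.List.Membership.DecPropositional as DecMembership
open import Relation.Binary.PropositionalEquality using (_≡_; _≢_; refl; trans; subst)
import Relation.Binary.PropositionalEquality as ≡
open import Relation.Nullary using (¬_; yes; no)
open import Relation.Unary using (Pred; Decidable)

module _ {n : ℕ} (H : Graph n) where

  open DecMembership (_≟_ {n}) using (_∈?_)

  Adj⇒≢ : ∀ {u v} → Adj H u v → u ≢ v
  Adj⇒≢ {u} uv refl with trans (≡.sym uv) (irrefl H u)
  ... | ()

  anyFin⇒∃ : (p : Fin n → Bool) → anyFin p ≡ true → ∃ λ w → p w ≡ true
  anyFin⇒∃ p = go (allFin n)
    where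
    go : (ws : List (Fin n)) → foldr (λ i b → p i ∨ b) false ws ≡ true → ∃ λ w → p w ≡ true
    go (w ∷ ws) h with p w in pw
    ... | true  = w , pw
    ... | false = go ws h

  reach-zero⇒≡ : ∀ {u w} → reach H zero u w ≡ true → u ≡ w
  reach-zero⇒≡ {u} {w} h with u ≟ w
  ... | yes u≡w = u≡w

  reach-suc : ∀ {k u w} → reach H k u w ≡ true → reach H (suc k) u w ≡ true
  reach-suc h rewrite h = refl

  reach-suc⁻ : ∀ {k u w} → reach H (suc k) u w ≡ true →
    reach H k u w ≡ true ⊎ (reach H k u w ≢ true × ∃ λ w′ → reach H k u w′ ≡ true × Adj H w′ w)
  reach-suc⁻ {k} {u} {w} h with reach H k u w
  ... | true  = inj₁ refl
  ... | false = let w′ , w′w = anyFin⇒∃ _ h in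
                inj₂ ((λ ()) , w′ , ∧-conicalˡ _ _ w′w , ∧-conicalʳ _ _ w′w)

  -- The path w ∷ inner ends at u; it is given by how it prefixes walks leaving u, so that it can
  -- be continued without naming its last vertex.
  record PathTo (w u : Fin n) : Set where
    field
      inner  : List (Fin n)
      prefix : ∀ {tl} → Walk H (u ∷ tl) → Walk H (w ∷ inner ++ tl)
      unique : Unique (w ∷ inner)
      visits : u ∈ w ∷ inner
  open PathTo

  -- The invariant that every vertex lies within k steps of u gives uniqueness: a vertex first
  -- reached at step k + 1 is not yet on the path.
  reach⇒shortPath : ∀ k {u} w → reach H k u w ≡ true →
                    Σ (PathTo w u) λ p → All (λ x → reach H k u x ≡ true) (w ∷ inner p)
  reach⇒shortPath zero {u} w h with reach-zero⇒≡ {u} {w} h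
  ... | refl = record { inner = [] ; prefix = λ wk → wk ; unique = [] ∷ [] ; visits = here refl }
                 , h ∷ []
  reach⇒shortPath (suc k) {u} w h with reach-suc⁻ {k} {u} h
  ... | inj₁ near-w =
    let p , near = reach⇒shortPath k w near-w in p , All.map (reach-suc {k} {u}) near
  ... | inj₂ (far-w , w′ , near-w′ , w′w) =
    let p , near = reach⇒shortPath k w′ near-w′
        fresh    = All.map (λ { near-x refl → far-w near-x }) near
    in record { inner  = w′ ∷ inner p
              ; prefix = λ wk → trans (Graph.sym H w w′) w′w ∷ prefix p wk
              ; unique = fresh ∷ unique p
              ; visits = there (visits p) }
     , h ∷ All.map (reach-suc {k} {u}) near

  Connected⇒PathTo : Connected H → ∀ w u → PathTo w u
  Connected⇒PathTo conn w u = proj₁ (reach⇒shortPath n w (conn u w))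

  Connected⇒path-through-edge : Connected H → ∀ {u v} → Adj H u v → ∀ r →
    ∃ λ ys → IsPath H (r ∷ ys) × u ∈ r ∷ ys × v ∈ r ∷ ys
  Connected⇒path-through-edge conn {u} {v} uv r with Connected⇒PathTo conn r u
  ... | p with v ∈? (r ∷ inner p)
  ... | yes v∈ = inner p , (subst (λ ys → Walk H (r ∷ ys)) (++-identityʳ (inner p)) (prefix p [ u ])
                             , unique p)
               , visits p , v∈
  ... | no v∉ = inner p ++ v ∷ [] , (prefix p (uv ∷ [ v ]) , Unique.++⁺ (unique p) ([] ∷ []) disjoint)
              , ∈-++⁺ˡ (visits p) , ∈-++⁺ʳ (r ∷ inner p) (here refl)
    where
    disjoint : ∀ {x} → x ∈ r ∷ inner p × x ∈ v ∷ [] → ⊥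
    disjoint (x∈ , here refl) = v∉ x∈

∈-tail : ∀ {a ℓ} {A : Set a} {M : Pred A ℓ} {x w ys} → ¬ M x → w ∈ x ∷ ys → M w → w ∈ ys
∈-tail {M = M} x∉M w∈ w∈M = Any.tail (λ w≡x → x∉M (subst M w≡x w∈M)) w∈

module _ {n : ℕ} {G : Graph n} where

  inducedPath-tail : ∀ {x ys} → IsInducedPath G (x ∷ ys) → IsInducedPath G ys
  inducedPath-tail {ys = []}    _                        = ([] , []) , λ ()
  inducedPath-tail {ys = _ ∷ _} ((_ ∷ wk , _ ∷ un) , ind) =
    (wk , un) , λ i j i+2≤j → ind (Fin.suc i) (Fin.suc j) (s≤s i+2≤j)

  module _ {M : Pred (Fin n) _} (M? : Decidable M) (module-M : IsModule G M) where

    inducedPath-skips-module : ∀ {x y zs w} → IsInducedPath G (x ∷ y ∷ zs) → ¬ M x → M y →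
                               w ∈ zs → ¬ M w
    inducedPath-skips-module {x} ((xy ∷ _ , _) , ind) x∉M y∈M w∈ w∈M with module-M x x∉M
    ... | inj₂ none = none _ y∈M xy
    ... | inj₁ all  = ind Fin.zero (Fin.suc (Fin.suc (index w∈))) (s≤s (s≤s z≤n))
                          (subst (Adj G x) (lookup-index w∈) (all _ w∈M))

    inducedPath-meets-module-once : ∀ {x ys u v} → IsInducedPath G (x ∷ ys) → ¬ M x →
      u ∈ x ∷ ys → v ∈ x ∷ ys → M u → M v → u ≡ v
    inducedPath-meets-module-once {x} {[]} _ x∉M u∈ _ u∈M _ with ∈-tail x∉M u∈ u∈M
    ... | ()
    inducedPath-meets-module-once {x} {y ∷ zs} path x∉M u∈ v∈ u∈M v∈M with M? y
    ... | no y∉M = inducedPath-meets-module-once (inducedPath-tail path) y∉M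
                     (∈-tail x∉M u∈ u∈M) (∈-tail x∉M v∈ v∈M) u∈M v∈M
    ... | yes y∈M = trans (only-y u∈ u∈M) (≡.sym (only-y v∈ v∈M))
      where
      only-y : ∀ {w} → w ∈ x ∷ y ∷ zs → M w → w ≡ y
      only-y w∈ w∈M with ∈-tail x∉M w∈ w∈M
      ... | here w≡y = w≡y
      ... | there w∈zs = ⊥-elim (inducedPath-skips-module path x∉M y∈M w∈zs w∈M)

lemma3 : ∀ {n k} (G : Graph n) → Connected G → (P : ModularPartition G k) →
    (T : Graph n) → MADTree G T → (r : Fin n) → IsRoot G T r →
    ∀ (j : Fin k) → j ≢ block P r →
      ¬ (∃₂ λ u v → Adj T u v × block P u ≡ j × block P v ≡ j)
lemma3 G _ P T ((_ , connected-T , _) , _) r root j j≢r (u , v , uv , u∈j , v∈j)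
  with Connected⇒path-through-edge T connected-T uv r
... | ys , path , u∈ , v∈ =
  Adj⇒≢ T uv (inducedPath-meets-module-once (λ x → block P x ≟ j) (isModule P j) (root ys path)
                (λ r∈j → j≢r (≡.sym r∈j)) u∈ v∈ u∈j v∈j)
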